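{- Let $G=(V,E)$ be a connected finite graph and let $\ell:E\to\mathbb{R}^+$ be a (positive) length function on $E$. Let $({\mathcal B}^*,r^*)$ be an optimal allocation for $G$ with respect to the (unrooted) budget radius problem. Then the subgraph $H=(V,E_{{\mathcal B}^*})$, where $E_{{\mathcal B}^*}=\{e\in E : {\mathcal B}^*(e)>0\}$, is a tree spanning $G$.
   Context: A valid budget allocation is a function ${\mathcal B}:E\to\mathbb{R}_{\ge 0}$ with $\sum_{e\in E}{\mathcal B}(e)=1$. Given ${\mathcal B}$, the weight of an edge $e$ is $\omega_{{\mathcal B}}(e)=\ell(e)/{\mathcal B}(e)$ (and $\omega_{{\mathcal B}}(e)=+\infty$ if ${\mathcal B}(e)=0$). The weighted distance $\delta_{{\mathcal B}}(u,v)$ is the minimum, over all simple paths $P$ from $u$ to $v$, of $\sum_{e\in P}\omega_{{\mathcal B}}(e)$. For $r\in V$, the weighted radius is $\operatorname{wr}_{{\mathcal B}}(r)=\max_{v\in V}\delta_{{\mathcal B}}(r,v)$. The rooted budget radius $\operatorname{BR}(G,r)$ is the minimum of $\operatorname{wr}_{{\mathcal B}}(r)$ over all valid allocations ${\mathcal B}$, and the budget radius is $\operatorname{BR}(G)=\min_{v\in V}\operatorname{BR}(G,v)$. An optimal allocation for $G$ (unrooted setting) is a pair $({\mathcal B}^*,r^*)$ with ${\mathcal B}^*$ a valid allocation, $r^*\in V$, and $\operatorname{wr}_{{\mathcal B}^*}(r^*)=\operatorname{BR}(G)$. -}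

module Defs where

open import Level using (0ℓ)
open import Data.Nat using (ℕ; zero; suc) renaming (_≤_ to _≤ℕ_)
open import Data.Fin using (Fin)
import Data.Fin as F
open import Data.List using (List; []; _∷_; length)
open import Data.List.Relation.Unary.All using (All)
open import Data.List.Relation.Unary.Unique.Propositional using (Unique)
open import Data.Product using (Σ; _×_; _,_; ∃)
open import Data.Sum using (_⊎_)
open import Relation.Binary.PropositionalEquality using (_≡_; _≢_; sym)
open import Relation.Binary.Structures using (IsStrictTotalOrder)
open import Relation.Binary.Definitions using (tri<; tri≈; tri>)
open import Relation.Nullary using (¬_)
open import Algebra.Structures using (IsCommutativeRing)

-- The real numbers, given axiomatically as a complete ordered field
-- (any two models are isomorphic, so quantifying over all models is
-- the same as speaking about ℝ).

record CompleteOrderedField : Set₁ where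
  infixl 6 _+_
  infixl 7 _*_
  infix 4 _<_ _≤_
  field
    R   : Set
    _+_ _*_ : R → R → R
    -_  : R → R
    0# 1# : R
    isCommutativeRing : IsCommutativeRing _≡_ _+_ _*_ -_ 0# 1#
    0≢1 : 0# ≢ 1#
    inv : (x : R) → x ≢ 0# → R
    inv-inverse : (x : R) (p : x ≢ 0#) → x * inv x p ≡ 1#
    _<_ : R → R → Set
    <-isStrictTotalOrder : IsStrictTotalOrder _≡_ _<_
    +-mono-< : ∀ {x y} z → x < y → x + z < y + z
    *-pos : ∀ {x y} → 0# < x → 0# < y → 0# < x * y
    sup : (P : R → Set) → (∃ λ x → P x) → (∃ λ b → ∀ x → P x → x < b ⊎ x ≡ b) →
          ∃ λ s → (∀ x → P x → x < s ⊎ x ≡ s) ×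
                  (∀ b → (∀ x → P x → x < b ⊎ x ≡ b) → s < b ⊎ s ≡ b)

  _≤_ : R → R → Set
  x ≤ y = x < y ⊎ x ≡ y

  open IsStrictTotalOrder <-isStrictTotalOrder public using (compare; irrefl)

record Graph : Set where
  field
    n m : ℕ
    src tgt : Fin m → Fin n
    loopless : ∀ e → src e ≢ tgt e
    noParallel : ∀ e e' → ((src e ≡ src e' × tgt e ≡ tgt e') ⊎ (src e ≡ tgt e' × tgt e ≡ src e')) → e ≡ e'

module _ (G : Graph) where
  open Graph G

  V E : Set
  V = Fin n
  E = Fin m

  Joins : E → V → V → Set
  Joins e u v = (src e ≡ u × tgt e ≡ v) ⊎ (src e ≡ v × tgt e ≡ u)

  data Walk : V → V → Set where
    []   : ∀ {v} → Walk v v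
    step : ∀ {u w v} (e : E) → Joins e u w → Walk w v → Walk u v

  edges : ∀ {u v} → Walk u v → List E
  edges [] = []
  edges (step e _ p) = e ∷ edges p

  vertices : ∀ {u v} → Walk u v → List V
  vertices {u} [] = u ∷ []
  vertices {u} (step e _ p) = u ∷ vertices p

  tailVertices : ∀ {u v} → Walk u v → List V
  tailVertices [] = []
  tailVertices (step e _ p) = vertices p

  SimplePath : V → V → Set
  SimplePath u v = Σ (Walk u v) λ p → Unique (vertices p)

  Connected : Set
  Connected = ∀ u v → Walk u v

  ConnectedSub : (E → Set) → Set
  ConnectedSub S = ∀ u v → Σ (Walk u v) λ p → All S (edges p)

  IsCycle : ∀ {v} → Walk v v → Set
  IsCycle p = (3 ≤ℕ length (edges p)) × Unique (tailVertices p)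

  AcyclicSub : (E → Set) → Set
  AcyclicSub S = ¬ (Σ V λ v → Σ (Walk v v) λ p → IsCycle p × All S (edges p))

  SpanningTreeSub : (E → Set) → Set
  SpanningTreeSub S = ConnectedSub S × AcyclicSub S

module _ (ℝF : CompleteOrderedField) where
  open CompleteOrderedField ℝF

  data R∞ : Set where
    fin : R → R∞
    ∞   : R∞

  _+∞_ : R∞ → R∞ → R∞
  fin x +∞ fin y = fin (x + y)
  fin x +∞ ∞ = ∞
  ∞ +∞ y = ∞

  data _≤∞_ : R∞ → R∞ → Set where
    fin≤fin : ∀ {x y} → x ≤ y → fin x ≤∞ fin y
    ≤∞-top  : ∀ {x} → x ≤∞ ∞

  sumFin : (k : ℕ) → (Fin k → R) → R
  sumFin zero f = 0#
  sumFin (suc k) f = f F.zero + sumFin k (λ i → f (F.suc i))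

  module _ (G : Graph) (ℓ : Fin (Graph.m G) → R) where
    open Graph G

    Allocation : Set
    Allocation = E G → R

    ValidAllocation : Allocation → Set
    ValidAllocation B = (∀ e → 0# ≤ B e) × sumFin m B ≡ 1#

    -- ω_B(e) = ℓ(e) / B(e), and +∞ when B(e) = 0
    -- (for a valid allocation B(e) ≥ 0, so B(e) ≯ 0 means B(e) = 0)
    weight : Allocation → E G → R∞
    weight B e with compare 0# (B e)
    ... | tri< 0<B B≢0 _ = fin (ℓ e * inv (B e) (λ eq → B≢0 (sym eq)))
    ... | tri≈ _ _ _ = ∞
    ... | tri> _ _ _ = ∞

    sumW : Allocation → List (E G) → R∞
    sumW B [] = fin 0#
    sumW B (e ∷ es) = weight B e +∞ sumW B es

    pathWeight : Allocation → ∀ {u v} → SimplePath G u v → R∞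
    pathWeight B (p , _) = sumW B (edges G p)

    IsWeightedDistance : Allocation → V G → V G → R∞ → Set
    IsWeightedDistance B u v d =
      (Σ (SimplePath G u v) λ P → pathWeight B P ≡ d) ×
      (∀ (P : SimplePath G u v) → d ≤∞ pathWeight B P)

    IsWeightedRadius : Allocation → V G → R∞ → Set
    IsWeightedRadius B r w =
      (Σ (V G) λ v → IsWeightedDistance B r v w) ×
      (∀ v d → IsWeightedDistance B r v d → d ≤∞ w)

    OptimalAllocation : Allocation → V G → Set
    OptimalAllocation B* r* =
      ValidAllocation B* ×
      (Σ R∞ λ w* → IsWeightedRadius B* r* w* ×
         (∀ B r w → ValidAllocation B → IsWeightedRadius B r w → w* ≤∞ w))

    InSupport : Allocation → E G → Set
    InSupport B e = 0# < B e

-- Let w* be the optimal radius and D the weighted distances from r*. The uniform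
-- allocation has finite radius, so w* and every D v are finite; hence shortest paths
-- from r* use only edges of positive budget, and the support is connected.
-- Suppose the support contains a cycle, let t be a cycle vertex maximising D and
-- eᵃ = at, eᵇ = bt its two cycle edges. If D b + ω(eᵇ) ≤ D t, every shortest path
-- through eᵃ can be rerouted through eᵇ without getting longer; otherwise no shortest
-- path uses eᵇ at all. Either way some support edge e₀ can be avoided by walks that
-- realise all distances, and giving its budget proportionally to the other edges
-- multiplies the weight of these walks by 1 − B*(e₀) < 1, so the radius from r*
-- drops below w* (which is positive, as a cycle has a vertex other than r*).
module Submission where

open import Defs
open import Algebra.Structures using (IsCommutativeRing)
open import Data.Empty using (⊥; ⊥-elim)
open import Data.Fin using (Fin) renaming (zero to fzero; suc to fsuc)
open import Data.Nat using (ℕ; zero; suc)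
import Data.Nat as ℕ
import Data.Nat.Properties
import Data.List.Properties
open import Data.List using (List; []; _∷_; length)
open import Data.List.Relation.Unary.All as All using (All; []; _∷_)
import Data.List.Relation.Unary.All.Properties as AllP
open import Data.List.Relation.Unary.Any using (here; there)
open import Data.List.Relation.Unary.Unique.Propositional using (Unique)
open import Data.List.Relation.Unary.AllPairs using ([]; _∷_)
open import Data.Product using (Σ; _×_; _,_; proj₁; proj₂)
import Data.Product
open import Data.Sum using (_⊎_; inj₁; inj₂)
import Data.Sum
open import Data.Vec.Functional using (updateAt)
open import Function using (const; _∘_)
open import Relation.Binary.Bundles using (TotalOrder)
open import Relation.Binary.Definitions using (tri<; tri≈; tri>)
open import Relation.Binary.PropositionalEquality
open import Relation.Nullary using (¬_)

module OrderedFieldProperties (F : CompleteOrderedField) where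
  open CompleteOrderedField F public
  open IsCommutativeRing isCommutativeRing public
    using ( +-comm; +-assoc; +-identityˡ; +-identityʳ; -‿inverseʳ
          ; *-comm; *-assoc; *-identityˡ; *-identityʳ; zeroʳ; distribˡ)
  open import Relation.Binary.Structures using (IsStrictTotalOrder)
  open IsStrictTotalOrder <-isStrictTotalOrder public using (asym) renaming (trans to <-trans)
  open import Algebra.Bundles using (CommutativeRing)

  commutativeRing : CommutativeRing _ _
  commutativeRing = record { isCommutativeRing = isCommutativeRing }

  open import Algebra.Properties.Ring (CommutativeRing.ring commutativeRing) public
    using (-‿distribʳ-*; -1*x≈-x; -‿involutive)
  open import Algebra.Properties.CommutativeSemigroup (CommutativeRing.*-commutativeSemigroup commutativeRing) public
    using () renaming (interchange to *-interchange; x∙yz≈y∙xz to x*[y*z]≡y*[x*z])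

  ≤-refl : ∀ {x} → x ≤ x
  ≤-refl = inj₂ refl

  <-≤-trans : ∀ {x y z} → x < y → y ≤ z → x < z
  <-≤-trans p (inj₁ q) = <-trans p q
  <-≤-trans p (inj₂ refl) = p

  ≤-<-trans : ∀ {x y z} → x ≤ y → y < z → x < z
  ≤-<-trans (inj₁ p) q = <-trans p q
  ≤-<-trans (inj₂ refl) q = q

  ≤-trans : ∀ {x y z} → x ≤ y → y ≤ z → x ≤ z
  ≤-trans (inj₁ p) q = inj₁ (<-≤-trans p q)
  ≤-trans (inj₂ refl) q = q

  <⇒≱ : ∀ {x y} → x < y → ¬ (y ≤ x)
  <⇒≱ p (inj₁ q) = asym p q
  <⇒≱ p (inj₂ refl) = irrefl refl p

  ≤-antisym : ∀ {x y} → x ≤ y → y ≤ x → x ≡ y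
  ≤-antisym (inj₂ e) _ = e
  ≤-antisym (inj₁ p) q = ⊥-elim (<⇒≱ p q)

  ≤-total : ∀ x y → x ≤ y ⊎ y < x
  ≤-total x y with compare x y
  ... | tri< p _ _ = inj₁ (inj₁ p)
  ... | tri≈ _ p _ = inj₁ (inj₂ p)
  ... | tri> _ _ p = inj₂ p

  +-monoˡ-< : ∀ z {x y} → x < y → z + x < z + y
  +-monoˡ-< z {x} {y} p = subst₂ _<_ (+-comm x z) (+-comm y z) (+-mono-< z p)

  +-monoʳ-≤ : ∀ z {x y} → x ≤ y → x + z ≤ y + z
  +-monoʳ-≤ z (inj₁ p) = inj₁ (+-mono-< z p)
  +-monoʳ-≤ z (inj₂ refl) = ≤-refl

  +-monoˡ-≤ : ∀ z {x y} → x ≤ y → z + x ≤ z + y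
  +-monoˡ-≤ z (inj₁ p) = inj₁ (+-monoˡ-< z p)
  +-monoˡ-≤ z (inj₂ refl) = ≤-refl

  +-mono-≤ : ∀ {x y z w} → x ≤ y → z ≤ w → x + z ≤ y + w
  +-mono-≤ {y = y} {z} p q = ≤-trans (+-monoʳ-≤ z p) (+-monoˡ-≤ y q)

  +-mono-<-≤ : ∀ {x y z w} → x < y → z ≤ w → x + z < y + w
  +-mono-<-≤ {y = y} {z} p q = <-≤-trans (+-mono-< z p) (+-monoˡ-≤ y q)

  x≤x+y : ∀ x {y} → 0# ≤ y → x ≤ x + y
  x≤x+y x {y} p = subst (_≤ x + y) (+-identityʳ x) (+-monoˡ-≤ x p)

  x<x+y : ∀ x {y} → 0# < y → x < x + y
  x<x+y x {y} p = subst (_< x + y) (+-identityʳ x) (+-monoˡ-< x p)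

  x≤y+x : ∀ x {y} → 0# ≤ y → x ≤ y + x
  x≤y+x x {y} p = subst (x ≤_) (+-comm x y) (x≤x+y x p)

  <⇒0<y-x : ∀ {x y} → x < y → 0# < y + - x
  <⇒0<y-x {x} p = subst (_< _) (-‿inverseʳ x) (+-mono-< (- x) p)

  0<y-x⇒< : ∀ {x y} → 0# < y + - x → x < y
  0<y-x⇒< {x} {y} p = subst₂ _<_ (+-identityˡ x) y-x+x≡y (+-mono-< x p)
    where
    y-x+x≡y : y + - x + x ≡ y
    y-x+x≡y = begin
      y + - x + x    ≡⟨ +-assoc y (- x) x ⟩
      y + (- x + x)  ≡⟨ cong (y +_) (trans (+-comm (- x) x) (-‿inverseʳ x)) ⟩
      y + 0#         ≡⟨ +-identityʳ y ⟩
      y              ∎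
      where open ≡-Reasoning

  x+y≡z⇒x≡z-y : ∀ {x y z} → x + y ≡ z → x ≡ z + - y
  x+y≡z⇒x≡z-y {x} {y} refl = begin
    x                ≡⟨ sym (+-identityʳ x) ⟩
    x + 0#           ≡⟨ cong (x +_) (sym (-‿inverseʳ y)) ⟩
    x + (y + - y)    ≡⟨ sym (+-assoc x y (- y)) ⟩
    x + y + - y      ∎
    where open ≡-Reasoning

  *-monoˡ-< : ∀ {c x y} → 0# < c → x < y → c * x < c * y
  *-monoˡ-< {c} {x} {y} 0<c x<y = 0<y-x⇒< (subst (0# <_) c[y-x]≡cy-cx (*-pos 0<c (<⇒0<y-x x<y)))
    where
    c[y-x]≡cy-cx : c * (y + - x) ≡ c * y + - (c * x)
    c[y-x]≡cy-cx = trans (distribˡ c y (- x)) (cong (c * y +_) (sym (-‿distribʳ-* c x)))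

  *-monoˡ-≤ : ∀ {c x y} → 0# ≤ c → x ≤ y → c * x ≤ c * y
  *-monoˡ-≤ (inj₁ 0<c) (inj₁ x<y) = inj₁ (*-monoˡ-< 0<c x<y)
  *-monoˡ-≤ _ (inj₂ refl) = ≤-refl
  *-monoˡ-≤ {x = x} {y} (inj₂ refl) (inj₁ _) = inj₂ (trans (zeroˡ′ x) (sym (zeroˡ′ y)))
    where
    zeroˡ′ : ∀ z → 0# * z ≡ 0#
    zeroˡ′ z = trans (*-comm 0# z) (zeroʳ z)

  x*y<y : ∀ {x y} → x < 1# → 0# < y → x * y < y
  x*y<y {x} {y} x<1 0<y = subst (_< y) (*-comm y x) (subst (y * x <_) (*-identityʳ y) (*-monoˡ-< 0<y x<1))

  0<1 : 0# < 1#
  0<1 with compare 0# 1#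
  ... | tri< 0<1 _ _ = 0<1
  ... | tri≈ _ 0≡1 _ = ⊥-elim (0≢1 0≡1)
  ... | tri> _ _ 1<0 = ⊥-elim (asym 1<0 (subst (0# <_) [-1]*[-1]≡1 (*-pos 0<-1 0<-1)))
    where
    0<-1 : 0# < - 1#
    0<-1 = subst₂ _<_ (-‿inverseʳ 1#) (+-identityˡ (- 1#)) (+-mono-< (- 1#) 1<0)
    [-1]*[-1]≡1 : - 1# * - 1# ≡ 1#
    [-1]*[-1]≡1 = trans (-1*x≈-x (- 1#)) (-‿involutive 1#)

  >0⇒≢0 : ∀ {x} → 0# < x → x ≢ 0#
  >0⇒≢0 p e = irrefl (sym e) p

  inv-pos : ∀ {x} (x≢0 : x ≢ 0#) → 0# < x → 0# < inv x x≢0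
  inv-pos {x} x≢0 0<x with ≤-total (inv x x≢0) 0#
  ... | inj₂ 0<x⁻¹ = 0<x⁻¹
  ... | inj₁ x⁻¹≤0 =
    ⊥-elim (<⇒≱ 0<1 (subst₂ _≤_ (inv-inverse x x≢0) (zeroʳ x) (*-monoˡ-≤ (inj₁ 0<x) x⁻¹≤0)))

  inv-unique : ∀ {x y} (x≢0 : x ≢ 0#) → x * y ≡ 1# → y ≡ inv x x≢0
  inv-unique {x} {y} x≢0 xy≡1 = begin
    y                  ≡⟨ sym (*-identityˡ y) ⟩
    1# * y             ≡⟨ cong (_* y) (sym (inv-inverse x x≢0)) ⟩
    x * x⁻¹ * y        ≡⟨ cong (_* y) (*-comm x x⁻¹) ⟩
    x⁻¹ * x * y        ≡⟨ *-assoc x⁻¹ x y ⟩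
    x⁻¹ * (x * y)      ≡⟨ cong (x⁻¹ *_) xy≡1 ⟩
    x⁻¹ * 1#           ≡⟨ *-identityʳ x⁻¹ ⟩
    x⁻¹                ∎
    where
    open ≡-Reasoning
    x⁻¹ : R
    x⁻¹ = inv x x≢0

  sumFin-cong : ∀ k {f g : Fin k → R} → (∀ i → f i ≡ g i) → sumFin F k f ≡ sumFin F k g
  sumFin-cong zero f≗g = refl
  sumFin-cong (suc k) f≗g = cong₂ _+_ (f≗g fzero) (sumFin-cong k (λ i → f≗g (fsuc i)))

  sumFin-*ˡ : ∀ k c (f : Fin k → R) → sumFin F k (λ i → c * f i) ≡ c * sumFin F k f
  sumFin-*ˡ zero c f = sym (zeroʳ c)
  sumFin-*ˡ (suc k) c f = trans (cong (c * f fzero +_) (sumFin-*ˡ k c (λ i → f (fsuc i)))) (sym (distribˡ c _ _))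

  sumFin-nonneg : ∀ k {f : Fin k → R} → (∀ i → 0# ≤ f i) → 0# ≤ sumFin F k f
  sumFin-nonneg zero _ = ≤-refl
  sumFin-nonneg (suc k) {f} 0≤f =
    subst (_≤ sumFin F (suc k) f) (+-identityʳ 0#) (+-mono-≤ (0≤f fzero) (sumFin-nonneg k (λ i → 0≤f (fsuc i))))

  ≤-sumFin : ∀ k {f : Fin k → R} → (∀ i → 0# ≤ f i) → ∀ i → f i ≤ sumFin F k f
  ≤-sumFin (suc k) 0≤f fzero = x≤x+y _ (sumFin-nonneg k (λ i → 0≤f (fsuc i)))
  ≤-sumFin (suc k) 0≤f (fsuc i) = ≤-trans (≤-sumFin k (λ i → 0≤f (fsuc i)) i) (x≤y+x _ (0≤f fzero))

  updateAt-0-nonneg : ∀ {k} {f : Fin k → R} → (∀ i → 0# ≤ f i) → ∀ i₀ i → 0# ≤ updateAt f i₀ (const 0#) i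
  updateAt-0-nonneg f≥0 fzero fzero = ≤-refl
  updateAt-0-nonneg f≥0 fzero (fsuc i) = f≥0 (fsuc i)
  updateAt-0-nonneg f≥0 (fsuc i₀) fzero = f≥0 fzero
  updateAt-0-nonneg f≥0 (fsuc i₀) (fsuc i) = updateAt-0-nonneg (λ j → f≥0 (fsuc j)) i₀ i

  sumFin≡1⇒index : ∀ k {f : Fin k → R} → sumFin F k f ≡ 1# → Fin k
  sumFin≡1⇒index zero sum≡1 = ⊥-elim (0≢1 sum≡1)
  sumFin≡1⇒index (suc k) _ = fzero

  sumFin-zeroAt : ∀ k (f : Fin k → R) i → sumFin F k f ≡ sumFin F k (updateAt f i (const 0#)) + f i
  sumFin-zeroAt (suc k) f fzero =
    trans (+-comm (f fzero) _) (cong (_+ f fzero) (sym (+-identityˡ _)))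
  sumFin-zeroAt (suc k) f (fsuc i) =
    trans (cong (f fzero +_) (sumFin-zeroAt k (λ j → f (fsuc j)) i)) (sym (+-assoc (f fzero) _ _))

module ExtendedRealProperties (F : CompleteOrderedField) where
  open OrderedFieldProperties F

  infixl 6 _⊞_
  infix 4 _≼_ _≺_

  _⊞_ : R∞ F → R∞ F → R∞ F
  _⊞_ = _+∞_ F

  _≼_ : R∞ F → R∞ F → Set
  _≼_ = _≤∞_ F

  data _≺_ : R∞ F → R∞ F → Set where
    fin<fin : ∀ {x y} → x < y → fin x ≺ fin y
    fin<∞   : ∀ {x} → fin x ≺ ∞

  ≼-refl : ∀ {a} → a ≼ a
  ≼-refl {fin x} = fin≤fin ≤-refl
  ≼-refl {∞} = ≤∞-top

  ≼-reflexive : ∀ {a b} → a ≡ b → a ≼ b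
  ≼-reflexive refl = ≼-refl

  ≼-trans : ∀ {a b c} → a ≼ b → b ≼ c → a ≼ c
  ≼-trans (fin≤fin p) (fin≤fin q) = fin≤fin (≤-trans p q)
  ≼-trans _ ≤∞-top = ≤∞-top

  ≼-antisym : ∀ {a b} → a ≼ b → b ≼ a → a ≡ b
  ≼-antisym (fin≤fin p) (fin≤fin q) = cong fin (≤-antisym p q)
  ≼-antisym ≤∞-top ≤∞-top = refl

  ≺⇒≼ : ∀ {a b} → a ≺ b → a ≼ b
  ≺⇒≼ (fin<fin p) = fin≤fin (inj₁ p)
  ≺⇒≼ fin<∞ = ≤∞-top

  ≺-≼-trans : ∀ {a b c} → a ≺ b → b ≼ c → a ≺ c
  ≺-≼-trans (fin<fin p) (fin≤fin q) = fin<fin (<-≤-trans p q)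
  ≺-≼-trans (fin<fin p) ≤∞-top = fin<∞
  ≺-≼-trans fin<∞ ≤∞-top = fin<∞

  ≼-≺-trans : ∀ {a b c} → a ≼ b → b ≺ c → a ≺ c
  ≼-≺-trans (fin≤fin p) (fin<fin q) = fin<fin (≤-<-trans p q)
  ≼-≺-trans (fin≤fin p) fin<∞ = fin<∞

  ≺⇒⋡ : ∀ {a b} → a ≺ b → ¬ (b ≼ a)
  ≺⇒⋡ (fin<fin p) (fin≤fin q) = <⇒≱ p q
  ≺⇒⋡ fin<∞ ()

  ≼-total : ∀ a b → a ≼ b ⊎ b ≺ a
  ≼-total (fin x) (fin y) with ≤-total x y
  ... | inj₁ x≤y = inj₁ (fin≤fin x≤y)
  ... | inj₂ y<x = inj₂ (fin<fin y<x)
  ≼-total (fin x) ∞ = inj₁ ≤∞-top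
  ≼-total ∞ (fin y) = inj₂ fin<∞
  ≼-total ∞ ∞ = inj₁ ≤∞-top

  ≼-totalOrder : TotalOrder _ _ _
  ≼-totalOrder = record
    { isTotalOrder = record
      { isPartialOrder = record
        { isPreorder = record
          { isEquivalence = isEquivalence ; reflexive = ≼-reflexive ; trans = ≼-trans }
        ; antisym = ≼-antisym }
      ; total = λ a b → Data.Sum.map₂ ≺⇒≼ (≼-total a b) } }

  ⊞-assoc : ∀ a b c → (a ⊞ b) ⊞ c ≡ a ⊞ (b ⊞ c)
  ⊞-assoc (fin x) (fin y) (fin z) = cong fin (+-assoc x y z)
  ⊞-assoc (fin x) (fin y) ∞ = refl
  ⊞-assoc (fin x) ∞ c = refl
  ⊞-assoc ∞ b c = refl

  ⊞-identityˡ : ∀ a → fin 0# ⊞ a ≡ a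
  ⊞-identityˡ (fin x) = cong fin (+-identityˡ x)
  ⊞-identityˡ ∞ = refl

  ⊞-identityʳ : ∀ a → a ⊞ fin 0# ≡ a
  ⊞-identityʳ (fin x) = cong fin (+-identityʳ x)
  ⊞-identityʳ ∞ = refl

  ⊞-mono : ∀ {a b c d} → a ≼ b → c ≼ d → a ⊞ c ≼ b ⊞ d
  ⊞-mono (fin≤fin p) (fin≤fin q) = fin≤fin (+-mono-≤ p q)
  ⊞-mono (fin≤fin p) ≤∞-top = ≤∞-top
  ⊞-mono ≤∞-top q = ≤∞-top

  ⊞-mono-≺ : ∀ {a b c d} → a ≺ b → c ≼ d → c ≺ ∞ → a ⊞ c ≺ b ⊞ d
  ⊞-mono-≺ (fin<fin p) (fin≤fin q) _ = fin<fin (+-mono-<-≤ p q)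
  ⊞-mono-≺ (fin<fin p) ≤∞-top fin<∞ = fin<∞
  ⊞-mono-≺ fin<∞ q fin<∞ = fin<∞

  a≼a⊞b : ∀ a {b} → fin 0# ≼ b → a ≼ a ⊞ b
  a≼a⊞b a {b} p = subst (_≼ a ⊞ b) (⊞-identityʳ a) (⊞-mono (≼-refl {a}) p)

  a≼b⊞a : ∀ a {b} → fin 0# ≼ b → a ≼ b ⊞ a
  a≼b⊞a a {b} p = subst (_≼ b ⊞ a) (⊞-identityˡ a) (⊞-mono p (≼-refl {a}))

  a≺a⊞b : ∀ {a b} → a ≺ ∞ → fin 0# ≺ b → a ≺ a ⊞ b
  a≺a⊞b fin<∞ (fin<fin p) = fin<fin (x<x+y _ p)
  a≺a⊞b fin<∞ fin<∞ = fin<∞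

  ⊞-finite : ∀ {a b} → a ≺ ∞ → b ≺ ∞ → a ⊞ b ≺ ∞
  ⊞-finite fin<∞ fin<∞ = fin<∞

  ⊞-finite⁻¹ : ∀ a b → a ⊞ b ≺ ∞ → a ≺ ∞ × b ≺ ∞
  ⊞-finite⁻¹ (fin x) (fin y) _ = fin<∞ , fin<∞

  scale : R → R∞ F → R∞ F
  scale c (fin x) = fin (c * x)
  scale c ∞ = ∞

  scale-⊞ : ∀ c a b → scale c (a ⊞ b) ≡ scale c a ⊞ scale c b
  scale-⊞ c (fin x) (fin y) = cong fin (distribˡ c x y)
  scale-⊞ c (fin x) ∞ = refl
  scale-⊞ c ∞ b = refl

  scale-mono-≼ : ∀ {c a b} → 0# ≤ c → a ≼ b → scale c a ≼ scale c b
  scale-mono-≼ 0≤c (fin≤fin a≤b) = fin≤fin (*-monoˡ-≤ 0≤c a≤b)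
  scale-mono-≼ 0≤c ≤∞-top = ≤∞-top

  scale-≺ : ∀ {c a} → c < 1# → fin 0# ≺ a → a ≺ ∞ → scale c a ≺ a
  scale-≺ c<1 (fin<fin 0<x) fin<∞ = fin<fin (x*y<y c<1 0<x)

module _ {A : Set} where
  open import Data.List using (_++_)
  open import Data.List.Membership.Propositional using (_∈_)
  open import Data.List.Membership.Propositional.Properties using (∈-++⁺ʳ)

  private
    remove : ∀ {x} (ys : List A) → x ∈ ys →
             Σ (List A) λ zs → length ys ≡ suc (length zs) × (∀ {y} → y ∈ ys → y ≢ x → y ∈ zs)
    remove (y ∷ ys) (here refl) = ys , refl , λ { (here refl) y≢y → ⊥-elim (y≢y refl) ; (there y∈ys) _ → y∈ys }
    remove (y ∷ ys) (there x∈ys) with remove ys x∈ys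
    ... | zs , eq , keep =
      y ∷ zs , cong suc eq , λ { (here refl) _ → here refl ; (there z∈ys) z≢x → there (keep z∈ys z≢x) }

  Unique⇒length≤ : ∀ {xs ys : List A} → Unique xs → (∀ {x} → x ∈ xs → x ∈ ys) → length xs ℕ.≤ length ys
  Unique⇒length≤ {[]} _ _ = ℕ.z≤n
  Unique⇒length≤ {x ∷ xs} {ys} (x∉xs ∷ u) xs⊆ys with remove ys (xs⊆ys (here refl))
  ... | zs , eq , keep = subst (suc (length xs) ℕ.≤_) (sym eq)
    (ℕ.s≤s (Unique⇒length≤ u (λ y∈xs → keep (xs⊆ys (there y∈xs)) (λ { refl → All.lookup x∉xs y∈xs refl }))))

  Unique-++⇒disjoint : ∀ {xs ys : List A} {x} → Unique (xs ++ ys) → x ∈ xs → x ∈ ys → ⊥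
  Unique-++⇒disjoint (x∉xs++ys ∷ _) (here refl) x∈ys = All.lookup x∉xs++ys (∈-++⁺ʳ _ x∈ys) refl
  Unique-++⇒disjoint (_ ∷ unique) (there x∈xs) x∈ys = Unique-++⇒disjoint unique x∈xs x∈ys

module WalkProperties (G : Graph) where
  open Graph G
  open import Data.Fin.Properties using (_≟_)
  open import Data.List using (_++_; map; concatMap; allFin)
  open import Data.List.Membership.Propositional using (_∈_; lose)
  open import Data.List.Membership.Propositional.Properties
    using (∈-++⁺ˡ; ∈-++⁺ʳ; ∈-map⁺; ∈-concatMap⁺; ∈-allFin)
  open import Data.List.Membership.DecPropositional (_≟_ {n}) using (_∈?_)
  open import Data.List.Relation.Binary.Sublist.Propositional using (_⊆_; []; _∷_; _∷ʳ_; ⊆-refl; ⊆-trans)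
  open import Data.List.Relation.Binary.Permutation.Propositional using (_↭_; ↭-sym; ↭⇒↭ₛ)
  import Data.List.Relation.Binary.Permutation.Propositional.Properties as ↭
  import Data.List.Relation.Binary.Permutation.Setoid.Properties (setoid (V G)) as ↭ₛ
  open import Data.Maybe using (Maybe; just; nothing)
  open import Relation.Nullary using (yes; no; contradiction)

  infixr 5 _++ʷ_

  _++ʷ_ : ∀ {u x v} → Walk G u x → Walk G x v → Walk G u v
  [] ++ʷ q = q
  step e j p ++ʷ q = step e j (p ++ʷ q)

  ++ʷ-assoc : ∀ {u x y v} (p : Walk G u x) (q : Walk G x y) (s : Walk G y v) →
              (p ++ʷ q) ++ʷ s ≡ p ++ʷ (q ++ʷ s)
  ++ʷ-assoc [] q s = refl
  ++ʷ-assoc (step e j p) q s = cong (step e j) (++ʷ-assoc p q s)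

  edges-++ʷ : ∀ {u x v} (p : Walk G u x) (q : Walk G x v) → edges G (p ++ʷ q) ≡ edges G p ++ edges G q
  edges-++ʷ [] q = refl
  edges-++ʷ (step e j p) q = cong (e ∷_) (edges-++ʷ p q)

  vertices≡∷tailVertices : ∀ {u v} (p : Walk G u v) → vertices G p ≡ u ∷ tailVertices G p
  vertices≡∷tailVertices [] = refl
  vertices≡∷tailVertices (step e j p) = refl

  vertices-++ʷ : ∀ {u x v} (p : Walk G u x) (q : Walk G x v) →
                 vertices G (p ++ʷ q) ≡ vertices G p ++ tailVertices G q
  vertices-++ʷ [] q = vertices≡∷tailVertices q
  vertices-++ʷ {u} (step e j p) q = cong (u ∷_) (vertices-++ʷ p q)

  tailVertices-++ʷ : ∀ {u x v} (p : Walk G u x) (q : Walk G x v) →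
                     tailVertices G (p ++ʷ q) ≡ tailVertices G p ++ tailVertices G q
  tailVertices-++ʷ [] q = refl
  tailVertices-++ʷ (step e j p) q = vertices-++ʷ p q

  length-vertices : ∀ {u v} (p : Walk G u v) → length (vertices G p) ≡ suc (length (edges G p))
  length-vertices [] = refl
  length-vertices (step e j p) = cong suc (length-vertices p)

  start∈vertices : ∀ {u v} (p : Walk G u v) → u ∈ vertices G p
  start∈vertices [] = here refl
  start∈vertices (step e j p) = here refl

  end∈vertices : ∀ {u v} (p : Walk G u v) → v ∈ vertices G p
  end∈vertices [] = here refl
  end∈vertices (step e j p) = there (end∈vertices p)

  Joins-sym : ∀ {e u w} → Joins G e u w → Joins G e w u
  Joins-sym (inj₁ (s , t)) = inj₂ (s , t)
  Joins-sym (inj₂ (s , t)) = inj₁ (s , t)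

  Joins⇒≢ : ∀ {e u w} → Joins G e u w → u ≢ w
  Joins⇒≢ {e} (inj₁ (refl , refl)) = loopless e
  Joins⇒≢ {e} (inj₂ (refl , refl)) = loopless e ∘ sym

  Joins-endpoints : ∀ {e x y u w} → Joins G e x y → Joins G e u w → (x ≡ u × y ≡ w) ⊎ (x ≡ w × y ≡ u)
  Joins-endpoints (inj₁ (refl , refl)) (inj₁ (refl , refl)) = inj₁ (refl , refl)
  Joins-endpoints (inj₁ (refl , refl)) (inj₂ (refl , refl)) = inj₂ (refl , refl)
  Joins-endpoints (inj₂ (refl , refl)) (inj₁ (refl , refl)) = inj₂ (refl , refl)
  Joins-endpoints (inj₂ (refl , refl)) (inj₂ (refl , refl)) = inj₁ (refl , refl)

  endpoints∈vertices : ∀ {u v e x y} (p : Walk G u v) → e ∈ edges G p → Joins G e x y →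
                       x ∈ vertices G p × y ∈ vertices G p
  endpoints∈vertices (step e j p) (here refl) j′ with Joins-endpoints j′ j
  ... | inj₁ (refl , refl) = here refl , there (start∈vertices p)
  ... | inj₂ (refl , refl) = there (start∈vertices p) , here refl
  endpoints∈vertices (step e j p) (there e∈p) j′ = Data.Product.map there there (endpoints∈vertices p e∈p j′)

  reverse : ∀ {u v} → Walk G u v → Walk G v u
  reverse [] = []
  reverse (step e j p) = reverse p ++ʷ step e (Joins-sym j) []

  All-reverse : ∀ {S : E G → Set} {u v} (p : Walk G u v) → All S (edges G p) → All S (edges G (reverse p))
  All-reverse [] [] = []
  All-reverse (step e j p) (s ∷ sp) =
    subst (All _) (sym (edges-++ʷ (reverse p) (step e (Joins-sym j) []))) (AllP.++⁺ (All-reverse p sp) (s ∷ []))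

  splitAtEdge : ∀ {u v e} (p : Walk G u v) → e ∈ edges G p →
                Σ (V G) λ x → Σ (V G) λ y → Σ (Walk G u x) λ p₁ → Σ (Joins G e x y) λ j → Σ (Walk G y v) λ p₂ →
                  p ≡ p₁ ++ʷ step e j p₂
  splitAtEdge (step e j p) (here refl) = _ , _ , [] , j , p , refl
  splitAtEdge (step e′ j′ p) (there e∈p) with splitAtEdge p e∈p
  ... | x , y , p₁ , j , p₂ , refl = x , y , step e′ j′ p₁ , j , p₂ , refl

  splitAtVertex : ∀ {u v x} (p : Walk G u v) → x ∈ vertices G p →
                  Σ (Walk G u x) λ p₁ → Σ (Walk G x v) λ p₂ → p ≡ p₁ ++ʷ p₂
  splitAtVertex [] (here refl) = [] , [] , refl
  splitAtVertex (step e j p) (here refl) = [] , step e j p , refl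
  splitAtVertex (step e j p) (there x∈p) with splitAtVertex p x∈p
  ... | p₁ , p₂ , refl = step e j p₁ , p₂ , refl

  private
    dropUntil : ∀ {u w v} (q : Walk G w v) → u ∈ vertices G q →
                Σ (Walk G u v) λ q′ → (Unique (vertices G q) → Unique (vertices G q′)) × edges G q′ ⊆ edges G q
    dropUntil [] (here refl) = [] , (λ u → u) , []
    dropUntil (step e j q) (here refl) = step e j q , (λ u → u) , ⊆-refl
    dropUntil (step e j q) (there u∈q) with dropUntil q u∈q
    ... | q′ , unique , q′⊆q = q′ , (λ { (_ ∷ u) → unique u }) , e ∷ʳ q′⊆q

  shortcut : ∀ {u v} (p : Walk G u v) → Σ (SimplePath G u v) λ P → edges G (proj₁ P) ⊆ edges G p
  shortcut [] = ([] , [] ∷ []) , []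
  shortcut {u} (step e j p) with shortcut p
  ... | (q , uq) , q⊆p with u ∈? vertices G q
  ...   | yes u∈q = let (q′ , unique , q′⊆q) = dropUntil q u∈q in (q′ , unique uq) , e ∷ʳ ⊆-trans q′⊆q q⊆p
  ...   | no u∉q = (step e j q , AllP.¬Any⇒All¬ _ u∉q ∷ uq) , refl ∷ q⊆p

  otherEnd : (e : E G) (u : V G) → Maybe (Σ (V G) (Joins G e u))
  otherEnd e u with src e ≟ u | tgt e ≟ u
  ... | yes s≡u | _ = just (tgt e , inj₁ (s≡u , refl))
  ... | no _ | yes t≡u = just (src e , inj₂ (refl , t≡u))
  ... | no _ | no _ = nothing

  otherEnd-complete : ∀ {e u w} (j : Joins G e u w) → otherEnd e u ≡ just (w , j)
  otherEnd-complete {e} (inj₁ (refl , refl)) with src e ≟ src e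
  ... | yes refl = refl
  ... | no s≢s = contradiction refl s≢s
  otherEnd-complete {e} (inj₂ (refl , refl)) with src e ≟ tgt e | tgt e ≟ tgt e
  ... | yes s≡t | _ = contradiction s≡t (loopless e)
  ... | no _ | yes refl = refl
  ... | no _ | no t≢t = contradiction refl t≢t

  module _ (v : V G) where
    private
      emptyWalks : (u : V G) → List (Walk G u v)
      emptyWalks u with u ≟ v
      ... | yes refl = [] ∷ []
      ... | no _ = []

      extend : ∀ {e u} → ((w : V G) → List (Walk G w v)) → Maybe (Σ (V G) (Joins G e u)) → List (Walk G u v)
      extend {e} walksFrom (just (w , j)) = map (step e j) (walksFrom w)
      extend walksFrom nothing = []

    walksOfLength≤ : ℕ → (u : V G) → List (Walk G u v)
    walksOfLength≤ zero u = emptyWalks u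
    walksOfLength≤ (suc k) u = emptyWalks u ++ concatMap (λ e → extend (walksOfLength≤ k) (otherEnd e u)) (allFin m)

    private
      []∈emptyWalks : [] ∈ emptyWalks v
      []∈emptyWalks with v ≟ v
      ... | yes refl = here refl
      ... | no v≢v = contradiction refl v≢v

    ∈-walksOfLength≤ : ∀ k {u} (p : Walk G u v) → length (edges G p) ℕ.≤ k → p ∈ walksOfLength≤ k u
    ∈-walksOfLength≤ zero [] _ = []∈emptyWalks
    ∈-walksOfLength≤ (suc k) [] _ = ∈-++⁺ˡ []∈emptyWalks
    ∈-walksOfLength≤ (suc k) {u} (step e j p) (ℕ.s≤s |p|≤k) =
      ∈-++⁺ʳ (emptyWalks u) (∈-concatMap⁺ _ (lose (∈-allFin e) step∈extend))
      where
      step∈extend : step e j p ∈ extend (walksOfLength≤ k) (otherEnd e u)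
      step∈extend rewrite otherEnd-complete j = ∈-map⁺ (step e j) (∈-walksOfLength≤ k p |p|≤k)

  SimplePath-length< : ∀ {u v} (P : SimplePath G u v) → length (edges G (proj₁ P)) ℕ.< n
  SimplePath-length< (p , up) =
    subst₂ ℕ._≤_ (length-vertices p) (Data.List.Properties.length-tabulate {n = n} (λ x → x))
      (Unique⇒length≤ up (λ {x} _ → ∈-allFin x))

  record Fork {v} (c : Walk G v v) (t : V G) : Set where
    field
      a b : V G
      eᵃ eᵇ : E G
      joinsᵃ : Joins G eᵃ a t
      joinsᵇ : Joins G eᵇ b t
      eᵃ≢eᵇ : eᵃ ≢ eᵇ
      a∈c : a ∈ tailVertices G c
      b∈c : b ∈ tailVertices G c
      eᵃ∈c : eᵃ ∈ edges G c
      eᵇ∈c : eᵇ ∈ edges G c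

  private
    splitLast : ∀ {u w v e} (j : Joins G e u w) (p : Walk G w v) →
                Σ (V G) λ b → Σ (Walk G u b) λ p₁ → Σ (E G) λ e′ → Σ (Joins G e′ b v) λ j′ →
                  step e j p ≡ p₁ ++ʷ step e′ j′ []
    splitLast j [] = _ , [] , _ , j , refl
    splitLast j (step e′ j′ p) with splitLast j′ p
    ... | b , p₁ , e″ , j″ , eq = b , step _ j p₁ , e″ , j″ , cong (step _ j) eq

    fork-of-ends : ∀ {t a b eᵃ eᵇ} (jᵃ : Joins G eᵃ t a) (p : Walk G a b) (jᵇ : Joins G eᵇ b t) →
                   IsCycle G (step eᵃ jᵃ (p ++ʷ step eᵇ jᵇ [])) → Fork (step eᵃ jᵃ (p ++ʷ step eᵇ jᵇ [])) t
    fork-of-ends {t} {a} {b} {eᵃ} {eᵇ} jᵃ p jᵇ (ℕ.s≤s 2≤|p| , unique) = record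
      { a = a ; b = b ; eᵃ = eᵃ ; eᵇ = eᵇ ; joinsᵃ = Joins-sym jᵃ ; joinsᵇ = jᵇ ; eᵃ≢eᵇ = eᵃ≢eᵇ
      ; a∈c = subst (a ∈_) (sym (vertices-++ʷ p _)) (∈-++⁺ˡ (start∈vertices p))
      ; b∈c = subst (b ∈_) (sym (vertices-++ʷ p _)) (∈-++⁺ˡ (end∈vertices p))
      ; eᵃ∈c = here refl
      ; eᵇ∈c = there (subst (eᵇ ∈_) (sym (edges-++ʷ p _)) (∈-++⁺ʳ (edges G p) (here refl)))
      }
      where
      closed : (q : Walk G b b) → Unique (vertices G (q ++ʷ step eᵇ jᵇ [])) →
               2 ℕ.≤ length (edges G (q ++ʷ step eᵇ jᵇ [])) → ⊥
      closed [] _ (ℕ.s≤s ())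
      closed (step e j q) (u∉q ∷ _) _ =
        All.lookup u∉q (subst (_ ∈_) (sym (vertices-++ʷ q _)) (∈-++⁺ˡ (end∈vertices q))) refl
      eᵃ≢eᵇ : eᵃ ≢ eᵇ
      eᵃ≢eᵇ refl with Joins-endpoints (Joins-sym jᵃ) jᵇ
      ... | inj₁ (refl , _) = closed p unique 2≤|p|
      ... | inj₂ (a≡t , _) = Joins⇒≢ jᵃ (sym a≡t)

  fork-at-start : ∀ {t} (c : Walk G t t) → IsCycle G c → Fork c t
  fork-at-start [] (() , _)
  fork-at-start (step e j []) (ℕ.s≤s () , _)
  fork-at-start {t} (step eᵃ jᵃ (step e j p)) with splitLast j p
  ... | b , p₁ , eᵇ , jᵇ , eq =
    subst (λ q → IsCycle G (step eᵃ jᵃ q) → Fork (step eᵃ jᵃ q) t) (sym eq) (fork-of-ends jᵃ p₁ jᵇ)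

  rotate : ∀ {v x} (c : Walk G v v) → x ∈ tailVertices G c →
           Σ (Walk G x x) λ c′ → tailVertices G c′ ↭ tailVertices G c × edges G c′ ↭ edges G c
  rotate (step e j p) x∈p with splitAtVertex p x∈p
  ... | p₁ , p₂ , refl = p₂ ++ʷ step e j p₁ , tailVertices↭ , edges↭
    where
    tailVertices↭ : tailVertices G (p₂ ++ʷ step e j p₁) ↭ vertices G (p₁ ++ʷ p₂)
    tailVertices↭ = subst₂ _↭_ (sym (tailVertices-++ʷ p₂ (step e j p₁))) (sym (vertices-++ʷ p₁ p₂))
                      (↭.++-comm (tailVertices G p₂) (vertices G p₁))
    edges↭ : edges G (p₂ ++ʷ step e j p₁) ↭ e ∷ edges G (p₁ ++ʷ p₂)
    edges↭ = subst₂ _↭_ (sym (edges-++ʷ p₂ (step e j p₁))) (cong (e ∷_) (sym (edges-++ʷ p₁ p₂)))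
               (↭.++-comm (edges G p₂) (e ∷ edges G p₁))

  cycle-fork : ∀ {v x} (c : Walk G v v) → IsCycle G c → x ∈ tailVertices G c → Fork c x
  cycle-fork c (3≤|c| , unique) x∈c with rotate c x∈c
  ... | c′ , tailVertices↭ , edges↭ = record
    { a = a ; b = b ; eᵃ = eᵃ ; eᵇ = eᵇ ; joinsᵃ = joinsᵃ ; joinsᵇ = joinsᵇ ; eᵃ≢eᵇ = eᵃ≢eᵇ
    ; a∈c = ↭.∈-resp-↭ tailVertices↭ a∈c ; b∈c = ↭.∈-resp-↭ tailVertices↭ b∈c
    ; eᵃ∈c = ↭.∈-resp-↭ edges↭ eᵃ∈c ; eᵇ∈c = ↭.∈-resp-↭ edges↭ eᵇ∈c
    }
    where
    cycle′ : IsCycle G c′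
    cycle′ = subst (3 ℕ.≤_) (sym (↭.↭-length edges↭)) 3≤|c|
           , ↭ₛ.Unique-resp-↭ (↭⇒↭ₛ (↭-sym tailVertices↭)) unique
    open Fork (fork-at-start c′ cycle′)

module Distances (F : CompleteOrderedField) (G : Graph) (connected : Connected G)
                 (ℓ : Fin (Graph.m G) → CompleteOrderedField.R F)
                 (ℓ-pos : ∀ e → CompleteOrderedField._<_ F (CompleteOrderedField.0# F) (ℓ e)) where
  open Graph G
  open OrderedFieldProperties F
  open ExtendedRealProperties F
  open WalkProperties G
  open import Data.Fin.Properties using (_≟_)
  open import Data.List using (_++_; filter; allFin)
  open import Data.List.Extrema ≼-totalOrder using (argmin; argmax; argmin-sel; f[argmin]≤f[xs]; f[xs]≤f[argmax])
  open import Data.List.Membership.Propositional using (_∈_)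
  open import Data.List.Membership.Propositional.Properties using (∈-filter⁺; ∈-filter⁻; ∈-allFin)
  open import Data.List.Relation.Binary.Sublist.Propositional using (_⊆_; []; _∷_; _∷ʳ_)
  open import Data.List.Relation.Unary.Unique.DecPropositional (_≟_ {n}) using (unique?)
  open import Data.Vec.Functional.Properties using (updateAt-minimal)
  open import Relation.Nullary using (Dec)

  W : Allocation F G ℓ → E G → R∞ F
  W = weight F G ℓ

  ΣW : Allocation F G ℓ → List (E G) → R∞ F
  ΣW = sumW F G ℓ

  walkWeight : Allocation F G ℓ → ∀ {u v} → Walk G u v → R∞ F
  walkWeight B p = ΣW B (edges G p)

  W-pos : ∀ B e → fin 0# ≺ W B e
  W-pos B e with compare 0# (B e)
  ... | tri< 0<Be _ _ = fin<fin (*-pos (ℓ-pos e) (inv-pos _ 0<Be))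
  ... | tri≈ _ _ _ = fin<∞
  ... | tri> _ _ _ = fin<∞

  W-finite⇒InSupport : ∀ B e → W B e ≺ ∞ → InSupport F G ℓ B e
  W-finite⇒InSupport B e We<∞ with compare 0# (B e)
  ... | tri< 0<Be _ _ = 0<Be
  ... | tri≈ _ _ _ = ⊥-elim (≺⇒⋡ We<∞ ≼-refl)
  ... | tri> _ _ _ = ⊥-elim (≺⇒⋡ We<∞ ≼-refl)

  W-∞ : ∀ B e → ¬ InSupport F G ℓ B e → W B e ≡ ∞
  W-∞ B e ¬0<Be with compare 0# (B e)
  ... | tri< 0<Be _ _ = ⊥-elim (¬0<Be 0<Be)
  ... | tri≈ _ _ _ = refl
  ... | tri> _ _ _ = refl

  W-InSupport : ∀ B e → InSupport F G ℓ B e → Σ (B e ≢ 0#) λ Be≢0 → W B e ≡ fin (ℓ e * inv (B e) Be≢0)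
  W-InSupport B e 0<Be with compare 0# (B e)
  ... | tri< _ _ _ = _ , refl
  ... | tri≈ ¬0<Be _ _ = ⊥-elim (¬0<Be 0<Be)
  ... | tri> ¬0<Be _ _ = ⊥-elim (¬0<Be 0<Be)

  ΣW-++ : ∀ B xs ys → ΣW B (xs ++ ys) ≡ ΣW B xs ⊞ ΣW B ys
  ΣW-++ B [] ys = sym (⊞-identityˡ (ΣW B ys))
  ΣW-++ B (x ∷ xs) ys = trans (cong (W B x ⊞_) (ΣW-++ B xs ys)) (sym (⊞-assoc (W B x) (ΣW B xs) (ΣW B ys)))

  ΣW-nonneg : ∀ B xs → fin 0# ≼ ΣW B xs
  ΣW-nonneg B [] = ≼-refl
  ΣW-nonneg B (x ∷ xs) =
    subst (_≼ ΣW B (x ∷ xs)) (⊞-identityˡ (fin 0#)) (⊞-mono (≺⇒≼ (W-pos B x)) (ΣW-nonneg B xs))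

  ΣW-mono-⊆ : ∀ B {xs ys} → xs ⊆ ys → ΣW B xs ≼ ΣW B ys
  ΣW-mono-⊆ B [] = ≼-refl
  ΣW-mono-⊆ B (y ∷ʳ xs⊆ys) = ≼-trans (ΣW-mono-⊆ B xs⊆ys) (a≼b⊞a _ (≺⇒≼ (W-pos B y)))
  ΣW-mono-⊆ B (refl ∷ xs⊆ys) = ⊞-mono ≼-refl (ΣW-mono-⊆ B xs⊆ys)

  ΣW-finite⇒All-InSupport : ∀ B xs → ΣW B xs ≺ ∞ → All (InSupport F G ℓ B) xs
  ΣW-finite⇒All-InSupport B [] _ = []
  ΣW-finite⇒All-InSupport B (e ∷ xs) finite with ⊞-finite⁻¹ (W B e) (ΣW B xs) finite
  ... | We-finite , rest-finite = W-finite⇒InSupport B e We-finite ∷ ΣW-finite⇒All-InSupport B xs rest-finite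

  walkWeight-++ʷ : ∀ B {u x v} (p : Walk G u x) (q : Walk G x v) → walkWeight B (p ++ʷ q) ≡ walkWeight B p ⊞ walkWeight B q
  walkWeight-++ʷ B p q = trans (cong (ΣW B) (edges-++ʷ p q)) (ΣW-++ B (edges G p) (edges G q))

  walkWeight-snoc : ∀ B {u x y e} (p : Walk G u x) (j : Joins G e x y) →
                    walkWeight B (p ++ʷ step e j []) ≡ walkWeight B p ⊞ W B e
  walkWeight-snoc B {e = e} p j = trans (walkWeight-++ʷ B p (step e j [])) (cong (walkWeight B p ⊞_) (⊞-identityʳ (W B e)))

  walkWeight-split : ∀ B {u x y v e} (p₁ : Walk G u x) (j : Joins G e x y) (p₂ : Walk G y v) →
                     walkWeight B (p₁ ++ʷ step e j p₂) ≡ (walkWeight B p₁ ⊞ W B e) ⊞ walkWeight B p₂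
  walkWeight-split B {e = e} p₁ j p₂ =
    trans (walkWeight-++ʷ B p₁ (step e j p₂)) (sym (⊞-assoc (walkWeight B p₁) (W B e) (walkWeight B p₂)))

  All-InSupport⇒ΣW-finite : ∀ B {xs} → All (InSupport F G ℓ B) xs → ΣW B xs ≺ ∞
  All-InSupport⇒ΣW-finite B [] = fin<∞
  All-InSupport⇒ΣW-finite B {e ∷ _} (0<Be ∷ rest) =
    ⊞-finite (subst (_≺ ∞) (sym (proj₂ (W-InSupport B e 0<Be))) fin<∞) (All-InSupport⇒ΣW-finite B rest)

  distance-by-enumeration : ∀ B u v → Σ (R∞ F) (IsWeightedDistance F G ℓ B u v)
  distance-by-enumeration B u v = walkWeight B best , ((best , best-simple) , refl) , best-minimal
    where
    IsSimple : ∀ {u v} → Walk G u v → Set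
    IsSimple p = Unique (vertices G p)
    simple? : (p : Walk G u v) → Dec (IsSimple p)
    simple? p = unique? (vertices G p)
    candidates : List (Walk G u v)
    candidates = filter simple? (walksOfLength≤ v n u)
    default : SimplePath G u v
    default = proj₁ (shortcut (connected u v))
    best : Walk G u v
    best = argmin (walkWeight B) (proj₁ default) candidates
    best-simple : IsSimple best
    best-simple with argmin-sel (walkWeight B) (proj₁ default) candidates
    ... | inj₁ best≡default = subst IsSimple (sym best≡default) (proj₂ default)
    ... | inj₂ best∈candidates = proj₂ (∈-filter⁻ simple? {xs = walksOfLength≤ v n u} best∈candidates)
    best-minimal : ∀ P → walkWeight B best ≼ walkWeight B (proj₁ P)
    best-minimal (p , p-simple) = All.lookup (f[argmin]≤f[xs] {f = walkWeight B} (proj₁ default) candidates)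
      (∈-filter⁺ simple? {xs = walksOfLength≤ v n u}
        (∈-walksOfLength≤ v n p (Data.Nat.Properties.<⇒≤ (SimplePath-length< (p , p-simple)))) p-simple)

  -- Sealed: unfolding the enumeration of walks during later type checking is prohibitively expensive.
  abstract
    distance : ∀ B u v → Σ (R∞ F) (IsWeightedDistance F G ℓ B u v)
    distance = distance-by-enumeration

  IsWeightedDistance⇒≼ : ∀ B u v {d d′} →
                         IsWeightedDistance F G ℓ B u v d → IsWeightedDistance F G ℓ B u v d′ → d′ ≼ d
  IsWeightedDistance⇒≼ B u v ((P , refl) , _) (_ , d′-minimal) = d′-minimal P

  abstract
    radius : ∀ B r → Σ (R∞ F) (IsWeightedRadius F G ℓ B r)
    radius B r = D farthest , (farthest , proj₂ (distance B r farthest)) , farthest-maximal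
      where
      D : V G → R∞ F
      D v = proj₁ (distance B r v)
      farthest : V G
      farthest = argmax D r (allFin n)
      farthest-maximal : ∀ v d → IsWeightedDistance F G ℓ B r v d → d ≼ D farthest
      farthest-maximal v d isDist = ≼-trans (IsWeightedDistance⇒≼ B r v (proj₂ (distance B r v)) isDist)
        (All.lookup (f[xs]≤f[argmax] r (allFin n)) (∈-allFin v))

  IsWeightedRadius-finite : ∀ {B r w} → (∀ e → InSupport F G ℓ B e) → IsWeightedRadius F G ℓ B r w → w ≺ ∞
  IsWeightedRadius-finite {B} B>0 ((_ , ((P , weight≡) , _)) , _) =
    subst (_≺ ∞) weight≡ (All-InSupport⇒ΣW-finite B {edges G (proj₁ P)} (All.tabulate (λ {e} _ → B>0 e)))

  module ShortestPaths (B : Allocation F G ℓ) (r : V G) where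
    D : V G → R∞ F
    D v = proj₁ (distance B r v)

    shortest : ∀ v → Walk G r v
    shortest v = proj₁ (proj₁ (proj₁ (proj₂ (distance B r v))))

    shortest-simple : ∀ v → Unique (vertices G (shortest v))
    shortest-simple v = proj₂ (proj₁ (proj₁ (proj₂ (distance B r v))))

    walkWeight-shortest : ∀ v → walkWeight B (shortest v) ≡ D v
    walkWeight-shortest v = proj₂ (proj₁ (proj₂ (distance B r v)))

    D≼walkWeight : ∀ {v} (p : Walk G r v) → D v ≼ walkWeight B p
    D≼walkWeight {v} p with shortcut p
    ... | P , P⊆p = ≼-trans (proj₂ (proj₂ (distance B r v)) P) (ΣW-mono-⊆ B P⊆p)

    D≼walkWeight-through : ∀ {x v} (p : Walk G r v) → x ∈ vertices G p → D x ≼ walkWeight B p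
    D≼walkWeight-through p x∈p with splitAtVertex p x∈p
    ... | p₁ , p₂ , refl = ≼-trans (D≼walkWeight p₁)
      (subst (walkWeight B p₁ ≼_) (sym (walkWeight-++ʷ B p₁ p₂)) (a≼a⊞b _ (ΣW-nonneg B (edges G p₂))))

    prefix-optimal : ∀ {y v} (p₁ : Walk G r y) (p₂ : Walk G y v) →
                     walkWeight B (p₁ ++ʷ p₂) ≡ D v → D v ≺ ∞ → walkWeight B p₁ ≼ D y
    prefix-optimal {y} {v} p₁ p₂ optimal Dv<∞ with ≼-total (walkWeight B p₁) (D y)
    ... | inj₁ p₁≼Dy = p₁≼Dy
    ... | inj₂ Dy≺p₁ = ⊥-elim (≺⇒⋡ shorter (D≼walkWeight (shortest y ++ʷ p₂)))
      where
      split : walkWeight B p₁ ⊞ walkWeight B p₂ ≡ D v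
      split = trans (sym (walkWeight-++ʷ B p₁ p₂)) optimal
      shorter : walkWeight B (shortest y ++ʷ p₂) ≺ D v
      shorter = subst₂ _≺_
        (sym (trans (walkWeight-++ʷ B (shortest y) p₂) (cong (_⊞ walkWeight B p₂) (walkWeight-shortest y))))
        split
        (⊞-mono-≺ Dy≺p₁ ≼-refl (proj₂ (⊞-finite⁻¹ _ _ (subst (_≺ ∞) (sym split) Dv<∞))))

    traversal-tight : ∀ {x y v e} (p₁ : Walk G r x) (j : Joins G e x y) (p₂ : Walk G y v) →
                      walkWeight B (p₁ ++ʷ step e j p₂) ≡ D v → D v ≺ ∞ → D x ⊞ W B e ≼ D y
    traversal-tight {e = e} p₁ j p₂ optimal Dv<∞ =
      ≼-trans (⊞-mono (D≼walkWeight p₁) (≼-refl {W B e}))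
        (subst (_≼ _) (walkWeight-snoc B p₁ j) (prefix-optimal (p₁ ++ʷ step e j []) p₂
          (trans (cong (walkWeight B) (++ʷ-assoc p₁ (step e j []) p₂)) optimal) Dv<∞))

    tight⇒≺ : ∀ {x y e} → D y ≺ ∞ → D x ⊞ W B e ≼ D y → D x ≺ D y
    tight⇒≺ {x} {e = e} Dy<∞ tight =
      ≺-≼-trans (a≺a⊞b (proj₁ (⊞-finite⁻¹ (D x) (W B e) (≼-≺-trans tight Dy<∞))) (W-pos B e)) tight

    shortest-edge-tight : ∀ {v e x y} → e ∈ edges G (shortest v) → D v ≺ ∞ → Joins G e x y →
                          D x ⊞ W B e ≼ D y ⊎ D y ⊞ W B e ≼ D x
    shortest-edge-tight {v} e∈p Dv<∞ j with splitAtEdge (shortest v) e∈p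
    ... | _ , _ , p₁ , j′ , p₂ , p≡ with Joins-endpoints j′ j
              | traversal-tight p₁ j′ p₂ (trans (cong (walkWeight B) (sym p≡)) (walkWeight-shortest v)) Dv<∞
    ... | inj₁ (refl , refl) | tight = inj₁ tight
    ... | inj₂ (refl , refl) | tight = inj₂ tight

  ¬InSupport⇒≡0 : ∀ {B} → ValidAllocation F G ℓ B → ∀ e → ¬ InSupport F G ℓ B e → B e ≡ 0#
  ¬InSupport⇒≡0 (nonneg , _) e ¬0<Be with nonneg e
  ... | inj₁ 0<Be = ⊥-elim (¬0<Be 0<Be)
  ... | inj₂ 0≡Be = sym 0≡Be

  InSupport-<1 : ∀ {B} → ValidAllocation F G ℓ B → ∀ {e₀ e₁} → e₁ ≢ e₀ →
                 InSupport F G ℓ B e₁ → B e₀ < 1#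
  InSupport-<1 {B} (nonneg , sum≡1) {e₀} {e₁} e₁≢e₀ 0<Be₁ =
    subst₂ _<_ (+-identityˡ (B e₀)) (trans (sym (sumFin-zeroAt m B e₀)) sum≡1)
      (+-mono-<-≤ (<-≤-trans 0<Be₁′ (≤-sumFin m nonneg′ e₁)) ≤-refl)
    where
    B′ : Allocation F G ℓ
    B′ = updateAt B e₀ (const 0#)
    nonneg′ : ∀ e → 0# ≤ B′ e
    nonneg′ = updateAt-0-nonneg nonneg e₀
    0<Be₁′ : 0# < B′ e₁
    0<Be₁′ = subst (0# <_) (sym (updateAt-minimal e₁ e₀ B e₁≢e₀)) 0<Be₁

  module WithoutEdge {B} (valid : ValidAllocation F G ℓ B) (e₀ : E G)
                     (0<B₀ : 0# < B e₀) (B₀<1 : B e₀ < 1#) where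
    c : R
    c = 1# + - B e₀

    0<c : 0# < c
    0<c = <⇒0<y-x B₀<1

    c<1 : c < 1#
    c<1 = subst (c <_) (+-identityʳ 1#) (+-monoˡ-< 1# -B₀<0)
      where
      -B₀<0 : - B e₀ < 0#
      -B₀<0 = subst₂ _<_ (+-identityˡ (- B e₀)) (-‿inverseʳ (B e₀)) (+-mono-< (- B e₀) 0<B₀)

    k : R
    k = inv c (>0⇒≢0 0<c)

    kc≡1 : k * c ≡ 1#
    kc≡1 = trans (*-comm k c) (inv-inverse c _)

    B′ : Allocation F G ℓ
    B′ = updateAt (λ e → k * B e) e₀ (const 0#)

    B′-valid : ValidAllocation F G ℓ B′
    B′-valid = updateAt-0-nonneg kB-nonneg e₀ , sum≡1
      where
      kB-nonneg : ∀ e → 0# ≤ k * B e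
      kB-nonneg e = subst (_≤ k * B e) (zeroʳ k) (*-monoˡ-≤ (inj₁ (inv-pos _ 0<c)) (proj₁ valid e))
      ΣkB≡k : sumFin F m (λ e → k * B e) ≡ k
      ΣkB≡k = trans (sumFin-*ˡ m k B) (trans (cong (k *_) (proj₂ valid)) (*-identityʳ k))
      sum≡1 : sumFin F m B′ ≡ 1#
      sum≡1 = begin
        sumFin F m B′          ≡⟨ x+y≡z⇒x≡z-y (sym (sumFin-zeroAt m (λ e → k * B e) e₀)) ⟩
        sumFin F m (λ e → k * B e) + - (k * B e₀)  ≡⟨ cong (_+ - (k * B e₀)) ΣkB≡k ⟩
        k + - (k * B e₀)       ≡⟨ cong₂ _+_ (sym (*-identityʳ k)) (-‿distribʳ-* k (B e₀)) ⟩
        k * 1# + k * - B e₀    ≡⟨ sym (distribˡ k 1# (- B e₀)) ⟩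
        k * c                  ≡⟨ kc≡1 ⟩
        1#                     ∎
        where open ≡-Reasoning

    B′≡kB : ∀ {e} → e ≢ e₀ → B′ e ≡ k * B e
    B′≡kB {e} e≢e₀ = updateAt-minimal e e₀ (λ e → k * B e) e≢e₀

    W-B′-InSupport : ∀ e → e ≢ e₀ → InSupport F G ℓ B e → W B′ e ≡ scale c (W B e)
    W-B′-InSupport e e≢e₀ 0<Be
      with W-InSupport B e 0<Be | W-InSupport B′ e (subst (0# <_) (sym (B′≡kB e≢e₀)) (*-pos (inv-pos _ 0<c) 0<Be))
    ... | Be≢0 , WBe≡ | B′e≢0 , WB′e≡ = begin
      W B′ e                               ≡⟨ WB′e≡ ⟩
      fin (ℓ e * inv (B′ e) B′e≢0)         ≡⟨ cong (λ z → fin (ℓ e * z)) (sym (inv-unique B′e≢0 B′e*cBe⁻¹≡1)) ⟩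
      fin (ℓ e * (c * inv (B e) Be≢0))     ≡⟨ cong fin (x*[y*z]≡y*[x*z] (ℓ e) c _) ⟩
      scale c (fin (ℓ e * inv (B e) Be≢0)) ≡⟨ cong (scale c) (sym WBe≡) ⟩
      scale c (W B e)                      ∎
      where
      open ≡-Reasoning
      B′e*cBe⁻¹≡1 : B′ e * (c * inv (B e) Be≢0) ≡ 1#
      B′e*cBe⁻¹≡1 = begin
        B′ e * (c * inv (B e) Be≢0)      ≡⟨ cong (_* (c * inv (B e) Be≢0)) (B′≡kB e≢e₀) ⟩
        k * B e * (c * inv (B e) Be≢0)   ≡⟨ *-interchange k (B e) c _ ⟩
        k * c * (B e * inv (B e) Be≢0)   ≡⟨ cong₂ _*_ kc≡1 (inv-inverse (B e) Be≢0) ⟩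
        1# * 1#                          ≡⟨ *-identityʳ 1# ⟩
        1#                               ∎

    W-B′ : ∀ e → e ≢ e₀ → W B′ e ≡ scale c (W B e)
    W-B′ e e≢e₀ with ≤-total (B e) 0#
    ... | inj₂ 0<Be = W-B′-InSupport e e≢e₀ 0<Be
    ... | inj₁ Be≤0 = trans (W-∞ B′ e (λ 0<B′e → irrefl (sym B′e≡0) 0<B′e)) (cong (scale c) (sym (W-∞ B e Be∉)))
      where
      Be∉ : ¬ InSupport F G ℓ B e
      Be∉ 0<Be = <⇒≱ 0<Be Be≤0
      B′e≡0 : B′ e ≡ 0#
      B′e≡0 = trans (B′≡kB e≢e₀) (trans (cong (k *_) (¬InSupport⇒≡0 valid e Be∉)) (zeroʳ k))

    ΣW-B′ : ∀ xs → ¬ (e₀ ∈ xs) → ΣW B′ xs ≡ scale c (ΣW B xs)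
    ΣW-B′ [] _ = cong fin (sym (zeroʳ c))
    ΣW-B′ (e ∷ xs) e₀∉e∷xs = begin
      W B′ e ⊞ ΣW B′ xs                   ≡⟨ cong₂ _⊞_ (W-B′ e (e₀∉e∷xs ∘ here ∘ sym)) (ΣW-B′ xs (e₀∉e∷xs ∘ there)) ⟩
      scale c (W B e) ⊞ scale c (ΣW B xs) ≡⟨ sym (scale-⊞ c (W B e) (ΣW B xs)) ⟩
      scale c (W B e ⊞ ΣW B xs)         ∎
      where open ≡-Reasoning


module OptimalSupport (F : CompleteOrderedField) (G : Graph) (connected : Connected G)
                      (ℓ : Fin (Graph.m G) → CompleteOrderedField.R F)
                      (ℓ-pos : ∀ e → CompleteOrderedField._<_ F (CompleteOrderedField.0# F) (ℓ e))
                      (B : Allocation F G ℓ) (r : V G) (optimal : OptimalAllocation F G ℓ B r) where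
  open Graph G
  open OrderedFieldProperties F
  open ExtendedRealProperties F
  open WalkProperties G
  open Distances F G connected ℓ ℓ-pos
  open ShortestPaths B r
  open import Data.Fin.Properties using (_≟_)
  open import Data.List using (_++_)
  open import Data.List.Extrema ≼-totalOrder using (argmax; argmax-sel; f[xs]≤f[argmax])
  open import Data.List.Membership.Propositional using (_∈_)
  open import Data.List.Membership.Propositional.Properties using (∈-++⁻)
  open import Data.List.Membership.DecPropositional (_≟_ {m}) using (_∈?_)
  open import Data.List.Relation.Binary.Sublist.Propositional using (lookup)
  open import Relation.Nullary using (yes; no)

  valid : ValidAllocation F G ℓ B
  valid = proj₁ optimal

  w* : R∞ F
  w* = proj₁ (proj₂ optimal)

  w*-radius : IsWeightedRadius F G ℓ B r w*
  w*-radius = proj₁ (proj₂ (proj₂ optimal))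

  w*-minimal : ∀ B′ r′ w → ValidAllocation F G ℓ B′ → IsWeightedRadius F G ℓ B′ r′ w → w* ≼ w
  w*-minimal = proj₂ (proj₂ (proj₂ optimal))

  w*<∞ : w* ≺ ∞
  w*<∞ = ≼-≺-trans (w*-minimal uniform r _ uniform-valid (proj₂ (radius uniform r))) uniform-radius<∞
    where
    s : R
    s = sumFin F m (λ _ → 1#)
    0<s : 0# < s
    0<s = <-≤-trans 0<1 (≤-sumFin m (λ _ → inj₁ 0<1) (sumFin≡1⇒index m (proj₂ valid)))
    uniform : Allocation F G ℓ
    uniform _ = inv s (>0⇒≢0 0<s)
    uniform-valid : ValidAllocation F G ℓ uniform
    uniform-valid = (λ _ → inj₁ (inv-pos _ 0<s))
                  , trans (sumFin-cong m (λ _ → sym (*-identityʳ _)))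
                          (trans (sumFin-*ˡ m _ (λ _ → 1#)) (trans (*-comm _ s) (inv-inverse s _)))
    uniform-radius<∞ : proj₁ (radius uniform r) ≺ ∞
    uniform-radius<∞ = IsWeightedRadius-finite (λ _ → inv-pos _ 0<s) (proj₂ (radius uniform r))

  D≼w* : ∀ v → D v ≼ w*
  D≼w* v = proj₂ w*-radius v (D v) (proj₂ (distance B r v))

  D<∞ : ∀ v → D v ≺ ∞
  D<∞ v = ≼-≺-trans (D≼w* v) w*<∞

  shortest⊆support : ∀ v → All (InSupport F G ℓ B) (edges G (shortest v))
  shortest⊆support v = ΣW-finite⇒All-InSupport B _ (subst (_≺ ∞) (sym (walkWeight-shortest v)) (D<∞ v))

  support-connected : ConnectedSub G (InSupport F G ℓ B)
  support-connected u v = reverse (shortest u) ++ʷ shortest v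
    , subst (All _) (sym (edges-++ʷ (reverse (shortest u)) (shortest v)))
        (AllP.++⁺ (All-reverse (shortest u) (shortest⊆support u)) (shortest⊆support v))

  0≺D : ∀ {x} → x ≢ r → fin 0# ≺ D x
  0≺D {x} x≢r = subst (fin 0# ≺_) (walkWeight-shortest x) (nonempty (shortest x) x≢r)
    where
    nonempty : ∀ {y} (p : Walk G r y) → y ≢ r → fin 0# ≺ walkWeight B p
    nonempty [] r≢r = ⊥-elim (r≢r refl)
    nonempty (step e j p) _ = ≺-≼-trans (W-pos B e) (a≼a⊞b (W B e) (ΣW-nonneg B (edges G p)))

  no-removable-edge : ∀ {e₀ e₁} → e₁ ≢ e₀ → InSupport F G ℓ B e₀ → InSupport F G ℓ B e₁ → fin 0# ≺ w* →
                      (∀ v → Σ (Walk G r v) λ p → ¬ (e₀ ∈ edges G p) × walkWeight B p ≼ D v) → ⊥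
  no-removable-edge {e₀} e₁≢e₀ 0<B₀ 0<B₁ 0≺w* avoiding = ≺⇒⋡ (scale-≺ c<1 0≺w* w*<∞) w*≼cw*
    where
    open WithoutEdge valid e₀ 0<B₀ (InSupport-<1 valid e₁≢e₀ 0<B₁)
    w′ : R∞ F
    w′ = proj₁ (radius B′ r)
    v′ : V G
    v′ = proj₁ (proj₁ (proj₂ (radius B′ r)))
    p′ : Walk G r v′
    p′ = proj₁ (avoiding v′)
    P′ : SimplePath G r v′
    P′ = proj₁ (shortcut p′)
    e₀∉P′ : ¬ (e₀ ∈ edges G (proj₁ P′))
    e₀∉P′ = proj₁ (proj₂ (avoiding v′)) ∘ lookup (proj₂ (shortcut p′))
    P′≼w* : walkWeight B (proj₁ P′) ≼ w*
    P′≼w* = ≼-trans (ΣW-mono-⊆ B (proj₂ (shortcut p′))) (≼-trans (proj₂ (proj₂ (avoiding v′))) (D≼w* v′))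
    w′≼cw* : w′ ≼ scale c w*
    w′≼cw* = ≼-trans (proj₂ (proj₂ (proj₁ (proj₂ (radius B′ r)))) P′)
      (subst (_≼ scale c w*) (sym (ΣW-B′ (edges G (proj₁ P′)) e₀∉P′)) (scale-mono-≼ (inj₁ 0<c) P′≼w*))
    w*≼cw* : w* ≼ scale c w*
    w*≼cw* = ≼-trans (w*-minimal B′ r w′ B′-valid (proj₂ (radius B′ r))) w′≼cw*

  reroute : ∀ {a b t eᵃ eᵇ} → Joins G eᵃ a t → Joins G eᵇ b t → eᵃ ≢ eᵇ →
            D a ≼ D t → D b ⊞ W B eᵇ ≼ D t →
            ∀ v → Σ (Walk G r v) λ p → ¬ (eᵃ ∈ edges G p) × walkWeight B p ≼ D v
  reroute {a} {b} {t} {eᵃ} {eᵇ} jᵃ jᵇ eᵃ≢eᵇ Da≼Dt tight v with eᵃ ∈? edges G (shortest v)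
  ... | no eᵃ∉p = shortest v , eᵃ∉p , ≼-reflexive (walkWeight-shortest v)
  ... | yes eᵃ∈p with splitAtEdge (shortest v) eᵃ∈p
  ...   | x , y , p₁ , j , p₂ , p≡
    with Joins-endpoints j jᵃ | trans (cong (walkWeight B) (sym p≡)) (walkWeight-shortest v)
  ...     | inj₂ (refl , refl) | split-optimal =
    ⊥-elim (≺⇒⋡ (tight⇒≺ (D<∞ a) (traversal-tight p₁ j p₂ split-optimal (D<∞ v))) Da≼Dt)
  ...     | inj₁ (refl , refl) | split-optimal = shortest b ++ʷ step eᵇ jᵇ p₂ , eᵃ∉detour , detour≼Dv
    where
    Db≺Dt : D b ≺ D t
    Db≺Dt = tight⇒≺ (D<∞ t) tight
    eᵃ∉detour : ¬ (eᵃ ∈ edges G (shortest b ++ʷ step eᵇ jᵇ p₂))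
    eᵃ∉detour eᵃ∈ with ∈-++⁻ (edges G (shortest b)) (subst (eᵃ ∈_) (edges-++ʷ (shortest b) _) eᵃ∈)
    ... | inj₁ eᵃ∈shortest-b =
      ≺⇒⋡ Db≺Dt (subst (D t ≼_) (walkWeight-shortest b)
        (D≼walkWeight-through (shortest b) (proj₂ (endpoints∈vertices (shortest b) eᵃ∈shortest-b jᵃ))))
    ... | inj₂ (here eᵃ≡eᵇ) = eᵃ≢eᵇ eᵃ≡eᵇ
    ... | inj₂ (there eᵃ∈p₂) =
      Unique-++⇒disjoint split-simple (end∈vertices p₁) (proj₁ (endpoints∈vertices p₂ eᵃ∈p₂ jᵃ))
      where
      split-simple : Unique (vertices G p₁ ++ vertices G p₂)
      split-simple = subst Unique (vertices-++ʷ p₁ (step eᵃ j p₂))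
                       (subst (λ p → Unique (vertices G p)) p≡ (shortest-simple v))
    Dt≼p₁eᵃ : D t ≼ walkWeight B p₁ ⊞ W B eᵃ
    Dt≼p₁eᵃ = subst (D t ≼_) (walkWeight-snoc B p₁ j) (D≼walkWeight (p₁ ++ʷ step eᵃ j []))
    detour≼Dv : walkWeight B (shortest b ++ʷ step eᵇ jᵇ p₂) ≼ D v
    detour≼Dv = subst₂ _≼_
      (sym (trans (walkWeight-split B (shortest b) jᵇ p₂)
                  (cong (λ d → d ⊞ W B eᵇ ⊞ walkWeight B p₂) (walkWeight-shortest b))))
      (trans (sym (walkWeight-split B p₁ j p₂)) split-optimal)
      (⊞-mono (≼-trans tight Dt≼p₁eᵃ) (≼-refl {walkWeight B p₂}))

  shortest-avoids : ∀ {b t eᵇ} → Joins G eᵇ b t → D b ≼ D t → D t ≺ D b ⊞ W B eᵇ →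
                    ∀ v → ¬ (eᵇ ∈ edges G (shortest v))
  shortest-avoids {b} {t} jᵇ Db≼Dt slack v eᵇ∈p with shortest-edge-tight eᵇ∈p (D<∞ v) jᵇ
  ... | inj₁ tight = ≺⇒⋡ slack tight
  ... | inj₂ tight = ≺⇒⋡ (tight⇒≺ (D<∞ b) tight) Db≼Dt

  no-fork-at-peak : ∀ {v t} {c : Walk G v v} → All (InSupport F G ℓ B) (edges G c) →
                    (∀ {x} → x ∈ tailVertices G c → D x ≼ D t) → Fork c t → ⊥
  no-fork-at-peak {t = t} c⊆support peak fork = Data.Sum.[ remove-eᵃ , remove-eᵇ ] (≼-total (D b ⊞ W B eᵇ) (D t))
    where
    open Fork fork
    0<Bᵃ : InSupport F G ℓ B eᵃ
    0<Bᵃ = All.lookup c⊆support eᵃ∈c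
    0<Bᵇ : InSupport F G ℓ B eᵇ
    0<Bᵇ = All.lookup c⊆support eᵇ∈c
    0≺w* : fin 0# ≺ w*
    0≺w* with t ≟ r
    ... | no t≢r = ≺-≼-trans (0≺D t≢r) (D≼w* t)
    ... | yes refl = ≺-≼-trans (0≺D (Joins⇒≢ joinsᵃ)) (D≼w* a)
    remove-eᵃ : D b ⊞ W B eᵇ ≼ D t → ⊥
    remove-eᵃ tight =
      no-removable-edge (eᵃ≢eᵇ ∘ sym) 0<Bᵃ 0<Bᵇ 0≺w* (reroute joinsᵃ joinsᵇ eᵃ≢eᵇ (peak a∈c) tight)
    remove-eᵇ : D t ≺ D b ⊞ W B eᵇ → ⊥
    remove-eᵇ slack = no-removable-edge eᵃ≢eᵇ 0<Bᵇ 0<Bᵃ 0≺w*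
      (λ v → shortest v , shortest-avoids joinsᵇ (peak b∈c) slack v , ≼-reflexive (walkWeight-shortest v))

  support-acyclic : AcyclicSub G (InSupport F G ℓ B)
  support-acyclic (_ , [] , (() , _) , _)
  support-acyclic (v₀ , c@(step _ _ p) , cycle , c⊆support) =
    no-fork-at-peak c⊆support (All.lookup (f[xs]≤f[argmax] v₀ (tailVertices G c))) (cycle-fork c cycle peak∈c)
    where
    peak∈c : argmax D v₀ (tailVertices G c) ∈ tailVertices G c
    peak∈c with argmax-sel D v₀ (tailVertices G c)
    ... | inj₁ peak≡v₀ = subst (_∈ tailVertices G c) (sym peak≡v₀) (end∈vertices p)
    ... | inj₂ peak∈ = peak∈

lemma1 : (ℝF : CompleteOrderedField) (G : Graph) →
         Connected G →
         (ℓ : Fin (Graph.m G) → CompleteOrderedField.R ℝF) →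
         (∀ e → CompleteOrderedField._<_ ℝF (CompleteOrderedField.0# ℝF) (ℓ e)) →
         (B* : Allocation ℝF G ℓ) (r* : V G) →
         OptimalAllocation ℝF G ℓ B* r* →
         SpanningTreeSub G (InSupport ℝF G ℓ B*)
lemma1 ℝF G connected ℓ ℓ-pos B* r* optimal = support-connected , support-acyclic
  where open OptimalSupport ℝF G connected ℓ ℓ-pos B* r* optimal
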